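{- Let $k\ge 3$ and $n>2k-1$. For every $0\leq j\leq |V^{(k)}_{n}|$, the word $\big(C^{j}(k\oplus W^{(k)}_{n-2k+1})\big)^2$ is a straddling square of $W^{(k)}_n$. Moreover, every straddling square $A^2$ of $W^{(k)}_{n}$ is of the form $A^2=\big(C^{j}(k\oplus W^{(k)}_{n-2k+1})\big)^2$ for some $0\leq j\leq |V^{(k)}_{n}|$.
   Context: Fix $k\ge3$. Words are over $\mathbb{N}$. Define the morphism $\varphi_k$ by $\varphi_k(ki+j)=(ki)(ki+j+1)$ if $0\le j\le k-2$ and $\varphi_k(ki+j)=(ki+j+1)$ if $j=k-1$; let $W^{(k)}_n=\varphi_k^n(0)$. It is known that for $n\ge k$, $W^{(k)}_n=W^{(k)}_{n-1}W^{(k)}_{n-2}\cdots W^{(k)}_{n-k+1}(k\oplus W^{(k)}_{n-k})$, where $m\oplus U$ adds $m$ to every digit of $U$. For $n\ge k$, a factor (occurrence) $A$ of $W^{(k)}_n$ is a straddling factor if $A=A_1A_2$ with $A_1,A_2$ nonempty, $A_1$ a suffix of $W^{(k)}_{n-1}\cdots W^{(k)}_{n-k+1}$ and $A_2$ a prefix of $k\oplus W^{(k)}_{n-k}$ in this decomposition; a straddling square is a straddling factor of the form $AA$. For $U=u_1\cdots u_p$ and $0\le j\le p-1$, $C^j(U)=u_{j+1}\cdots u_pu_1\cdots u_j$. For $n>2k-1$: $V^{(k)}_n=W^{(k)}_{n-2k}W^{(k)}_{n-2k-1}\cdots W^{(k)}_{0}$ if $2k-1<n<3k-2$, and $V^{(k)}_n=W^{(k)}_{n-2k}W^{(k)}_{n-2k-1}\cdots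 W^{(k)}_{n-3k+3}$ if $n\ge 3k-2$. -}

module Defs where

open import Data.Nat using (ℕ; zero; suc; _+_; _*_; _∸_; _<_; _≤_; NonZero)
open import Data.Nat.DivMod using (_%_; _/_)
open import Data.Nat.Properties using (_<?_)
open import Data.List using (List; []; _∷_; _++_; [_]; map; concatMap; drop; take)
open import Data.Product using (∃; ∃₂; _×_; _,_)
open import Relation.Binary.PropositionalEquality using (_≡_; _≢_)
open import Relation.Nullary using (yes; no)

Word : Set
Word = List ℕ

-- The morphism φ_k on a letter m = k*i + j (0 ≤ j ≤ k-1):
--   φ_k(m) = (k*i) (m+1)  if j ≤ k-2,   φ_k(m) = (m+1)  if j = k-1.
φ : (k : ℕ) → .{{NonZero k}} → ℕ → Word
φ k m with suc (m % k) <? k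
... | yes _ = (k * (m / k)) ∷ suc m ∷ []
... | no  _ = suc m ∷ []

φ* : (k : ℕ) → .{{NonZero k}} → Word → Word
φ* k = concatMap (φ k)

W : (k : ℕ) → .{{NonZero k}} → ℕ → Word
W k zero    = [ 0 ]
W k (suc n) = φ* k (W k n)

_⊕_ : ℕ → Word → Word
m ⊕ U = map (m +_) U

Wrange : (k : ℕ) → .{{NonZero k}} → ℕ → ℕ → Word
Wrange k top zero    = []
Wrange k top (suc l) = W k top ++ Wrange k (top ∸ 1) l

-- Left part of the decomposition W_n = W_{n-1} ⋯ W_{n-k+1} (k ⊕ W_{n-k})
leftPart : (k : ℕ) → .{{NonZero k}} → ℕ → Word
leftPart k n = Wrange k (n ∸ 1) (k ∸ 1)

rightPart : (k : ℕ) → .{{NonZero k}} → ℕ → Word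
rightPart k n = k ⊕ W k (n ∸ k)

IsSuffix : Word → Word → Set
IsSuffix A P = ∃ λ X → P ≡ X ++ A

IsPrefix : Word → Word → Set
IsPrefix A Q = ∃ λ Y → Q ≡ A ++ Y

StraddlingFactor : (k : ℕ) → .{{NonZero k}} → ℕ → Word → Set
StraddlingFactor k n A =
  ∃₂ λ A₁ A₂ → A₁ ≢ [] × A₂ ≢ [] × A ≡ A₁ ++ A₂
             × IsSuffix A₁ (leftPart k n) × IsPrefix A₂ (rightPart k n)

StraddlingSquare : (k : ℕ) → .{{NonZero k}} → ℕ → Word → Set
StraddlingSquare k n S = (∃ λ B → S ≡ B ++ B) × StraddlingFactor k n S

C : ℕ → Word → Word
C j U = drop j U ++ take j U

V : (k : ℕ) → .{{NonZero k}} → ℕ → Word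
V k n with n <? 3 * k ∸ 2
... | yes _ = Wrange k (n ∸ 2 * k) (suc (n ∸ 2 * k))
... | no  _ = Wrange k (n ∸ 2 * k) (k ∸ 2)

-- Write n = 2k − 1 + t, so that W_n = L R with L = W_{n−1} ⋯ W_{n−k+1} and R = k ⊕ W_{n−k}, and let
-- U = k ⊕ W_t.  By the recurrence L ends with U, while R starts with U (k ⊕ V) c ⋯, where V = V_n is the
-- longest prefix of W_t that reappears right after W_t in W_{t+1}; hence drop j U | U take j U is a
-- straddling square (C^j U)² for every j ≤ |V|.
-- Conversely let A₁ | A₂ = B B straddle.  If |A₁| ≤ |B|, then A₁ is a suffix of the last block W_{t+k}
-- of L and ends with its unique maximum k + t; since a letter preceding an occurrence of W_t in some W_i
-- always exceeds t, R has no factor (k + t) U, and this pins B down to a conjugate C^j U with j ≤ |V|.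
-- If |A₁| > |B|, then A₁ = E A₂ E starts inside a block W_j of L whose maximum j occurs only once in A₁,
-- so it ends A₂; this forces A₂ = k ⊕ W_{j−k} and makes a run of consecutive blocks a suffix of a longer
-- run starting at the same block, which their last letters rule out.

module Submission where

open import Data.Nat using (ℕ; zero; suc; _+_; _*_; _∸_; _≤_; _<_; z≤n; s≤s; NonZero; _≟_)
open import Data.Nat.Properties
open import Data.Nat.DivMod
open import Data.Nat.Tactic.RingSolver using (solve-∀)
open import Data.List using (List; []; _∷_; _++_; [_]; _∷ʳ_; length; map; head; drop; take; initLast; _∷ʳ′_)
open import Data.List.Properties
  using (length-++; length-++-≤ʳ; map-++; length-map; map-injective; concatMap-++; take++drop≡id; ++-assoc; ++-identityʳ;
         ++-cancelˡ; ++-cancelʳ; ++-conicalˡ; ++-conicalʳ;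
         ∷-injective; ∷-injectiveˡ; ∷-injectiveʳ; ∷ʳ-injective; ∷ʳ-injectiveˡ; ∷ʳ-injectiveʳ)
open import Data.List.Relation.Unary.All as All using (All; []; _∷_)
open import Data.List.Relation.Unary.All.Properties using (++⁺; ++⁻ˡ; ++⁻ʳ; map⁺; map⁻)
open import Data.List.Relation.Unary.Linked using (Linked; []; [-]; _∷_; _∷′_)
open import Data.Maybe using (just)
open import Data.Maybe.Relation.Binary.Connected using (Connected; just; just-nothing)
open import Data.Product using (∃; ∃₂; _×_; _,_)
open import Data.Sum using (_⊎_; inj₁; inj₂)
open import Data.Empty using (⊥; ⊥-elim)
open import Relation.Binary.PropositionalEquality hiding ([_])
open import Relation.Nullary using (¬_; yes; no)
open import Defs

private variable
  X Y : Set

++-equidivisible : ∀ (A : List X) {B} C {D} → A ++ B ≡ C ++ D →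
  (∃ λ E → C ≡ A ++ E × B ≡ E ++ D) ⊎ (∃ λ E → A ≡ C ++ E × D ≡ E ++ B)
++-equidivisible []      C       eq = inj₁ (C , refl , eq)
++-equidivisible (a ∷ A) []      eq = inj₂ (a ∷ A , refl , sym eq)
++-equidivisible (a ∷ A) (c ∷ C) eq with refl , eq′ ← ∷-injective eq
  with ++-equidivisible A C eq′
... | inj₁ (E , p , q) = inj₁ (E , cong (a ∷_) p , q)
... | inj₂ (E , p , q) = inj₂ (E , cong (a ∷_) p , q)

[]≢++∷ : ∀ (P : List X) {c E} → [] ≢ P ++ c ∷ E
[]≢++∷ []      ()
[]≢++∷ (_ ∷ _) ()

suffix-∷ʳ : ∀ Pf A (I : List X) {a} → I ∷ʳ a ≡ Pf ++ A → A ≢ [] →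
  ∃ λ A′ → A ≡ A′ ∷ʳ a × I ≡ Pf ++ A′
suffix-∷ʳ Pf A I eq A≢[] with initLast A
... | []       = ⊥-elim (A≢[] refl)
... | A′ ∷ʳ′ b with refl , refl ← ∷ʳ-injective I (Pf ++ A′) (trans eq (sym (++-assoc Pf A′ [ b ])))
  = A′ , refl , refl

++-∷ʳ-++ : ∀ (E A : List X) {M} T → E ++ (A ∷ʳ M) ++ T ≡ (E ++ A) ++ M ∷ T
++-∷ʳ-++ E A {M} T = trans (cong (E ++_) (++-assoc A [ M ] T)) (sym (++-assoc E A (M ∷ T)))

length-++-< : ∀ (A : List X) {B} → B ≢ [] → length A < length (A ++ B)
length-++-< []      {[]}    B≢[] = ⊥-elim (B≢[] refl)
length-++-< []      {_ ∷ _} _    = s≤s z≤n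
length-++-< (_ ∷ A)         B≢[] = s≤s (length-++-< A B≢[])

length-≤-infix : ∀ (A B C : List X) → length B ≤ length (A ++ B ++ C)
length-≤-infix A B C = begin
  length B                     ≤⟨ m≤m+n (length B) (length C) ⟩
  length B + length C          ≡⟨ length-++ B ⟨
  length (B ++ C)              ≤⟨ m≤n+m _ (length A) ⟩
  length A + length (B ++ C)   ≡⟨ length-++ A ⟨
  length (A ++ B ++ C)         ∎
  where open ≤-Reasoning

length-commonPrefix-≤ : ∀ (Z : List X) {S₁ S₂} V {c d Y₁ Y₂} → c ≢ d →
  Z ++ S₁ ≡ V ++ c ∷ Y₁ → Z ++ S₂ ≡ V ++ d ∷ Y₂ → length Z ≤ length V
length-commonPrefix-≤ []      V       c≢d e₁ e₂ = z≤n
length-commonPrefix-≤ (_ ∷ Z) []      c≢d e₁ e₂ = ⊥-elim (c≢d (trans (sym (∷-injectiveˡ e₁)) (∷-injectiveˡ e₂)))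
length-commonPrefix-≤ (_ ∷ Z) (_ ∷ V) c≢d e₁ e₂ = s≤s (length-commonPrefix-≤ Z V c≢d (∷-injectiveʳ e₁) (∷-injectiveʳ e₂))

take-++ˡ : ∀ j (A : List X) {B} → j ≤ length A → take j (A ++ B) ≡ take j A
take-++ˡ zero    A       j≤ = refl
take-++ˡ (suc j) (a ∷ A) (s≤s j≤) = cong (a ∷_) (take-++ˡ j A j≤)

drop-≢[] : ∀ j (A : List X) → j < length A → drop j A ≢ []
drop-≢[] zero    (_ ∷ _) _ ()
drop-≢[] (suc j) (_ ∷ A) (s≤s j<) = drop-≢[] j A j<

drop-length-++ : ∀ (Z : List X) A → drop (length Z) (Z ++ A) ≡ A
drop-length-++ []      A = refl
drop-length-++ (_ ∷ Z) A = drop-length-++ Z A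

take-length-++ : ∀ (Z : List X) A → take (length Z) (Z ++ A) ≡ Z
take-length-++ []      A = refl
take-length-++ (z ∷ Z) A = cong (z ∷_) (take-length-++ Z A)

C-length-++ : ∀ (Z A : Word) → C (length Z) (Z ++ A) ≡ A ++ Z
C-length-++ Z A = cong₂ _++_ (drop-length-++ Z A) (take-length-++ Z A)

Linked-middle : ∀ {R : X → X → Set} P {a b Q} → Linked R (P ++ a ∷ b ∷ Q) → R a b
Linked-middle []          (Rab ∷ _) = Rab
Linked-middle (_ ∷ [])    (_ ∷ l)   = Linked-middle [] l
Linked-middle (_ ∷ p ∷ P) (_ ∷ l)   = Linked-middle (p ∷ P) l

map-++⁻ : ∀ (f : X → Y) w A {B} → map f w ≡ A ++ B →
  ∃₂ λ a b → w ≡ a ++ b × map f a ≡ A × map f b ≡ B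
map-++⁻ f w       []      eq = [] , w , refl , refl , eq
map-++⁻ f []      (_ ∷ _) ()
map-++⁻ f (x ∷ w) (_ ∷ A) eq with refl , eq′ ← ∷-injective eq
  with a , b , refl , refl , refl ← map-++⁻ f w A eq′ = x ∷ a , b , refl , refl , refl

⊕-++ : ∀ m (A B : Word) → m ⊕ (A ++ B) ≡ m ⊕ A ++ m ⊕ B
⊕-++ m = map-++ (m +_)

length-⊕ : ∀ m (A : Word) → length (m ⊕ A) ≡ length A
length-⊕ m = length-map (m +_)

⊕-All≥ : ∀ m (A : Word) → All (m ≤_) (m ⊕ A)
⊕-All≥ m []      = []
⊕-All≥ m (x ∷ A) = m≤m+n m x ∷ ⊕-All≥ m A

⊕-factor⁻ : ∀ m w u P {Q} → m ⊕ w ≡ P ++ m ⊕ u ++ Q → ∃₂ λ P′ Q′ → w ≡ P′ ++ u ++ Q′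
⊕-factor⁻ m w u P eq with a , b , w≡ , _ , eq′ ← map-++⁻ (m +_) w P eq
  with c , d , b≡ , c≡ , _ ← map-++⁻ (m +_) b (m ⊕ u) eq′ =
  a , d , trans w≡ (cong (a ++_) (trans b≡ (cong (_++ d) (map-injective (+-cancelˡ-≡ m _ _) c≡))))

first-occurrence-unique : ∀ {M : X} P Q {A B} → All (_≢ M) P → All (_≢ M) Q → P ++ M ∷ A ≡ Q ++ M ∷ B → P ≡ Q × A ≡ B
first-occurrence-unique []      []      _          _          eq = refl , ∷-injectiveʳ eq
first-occurrence-unique []      (_ ∷ _) _          (q≢M ∷ _)  eq = ⊥-elim (q≢M (sym (∷-injectiveˡ eq)))
first-occurrence-unique (_ ∷ _) []      (p≢M ∷ _)  _          eq = ⊥-elim (p≢M (∷-injectiveˡ eq))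
first-occurrence-unique (p ∷ P) (q ∷ Q) (_ ∷ pP)   (_ ∷ pQ)   eq
  with refl , eq′ ← ∷-injective eq with refl , refl ← first-occurrence-unique P Q pP pQ eq′ = refl , refl

split-at-first : ∀ (M : ℕ) E → All (_≢ M) E ⊎ ∃₂ λ E₁ E₂ → E ≡ E₁ ++ M ∷ E₂ × All (_≢ M) E₁
split-at-first M []      = inj₁ []
split-at-first M (x ∷ E) with x ≟ M
... | yes refl = inj₂ ([] , E , refl , [])
... | no x≢M with split-at-first M E
...   | inj₁ pE                       = inj₁ (x≢M ∷ pE)
...   | inj₂ (E₁ , E₂ , refl , pE₁)   = inj₂ (x ∷ E₁ , E₂ , refl , x≢M ∷ pE₁)

All≢-∉ : ∀ {x : X} P {Q} → ¬ All (_≢ x) (P ++ x ∷ Q)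
All≢-∉ P all with x≢x ∷ _ ← ++⁻ʳ P all = x≢x refl

-- j occurs once on the left, so it lies in A₂ rather than in either copy of E.
solitary-letter-ends-middle : ∀ {j} α′ Z E A₂ → All (_≢ j) α′ → All (_≢ j) Z →
  (∀ {z Z′} → Z ≡ z ∷ Z′ → All (_≢ z) A₂) → α′ ++ j ∷ Z ≡ E ++ A₂ ++ E → Z ≡ E × α′ ∷ʳ j ≡ E ++ A₂
solitary-letter-ends-middle {j} α′ Z E A₂ α′≢ Z≢ head∉A₂ eq with split-at-first j E
... | inj₂ (E₁ , E₂ , refl , E₁≢)
  with _ , refl ← first-occurrence-unique α′ E₁ α′≢ E₁≢ (trans eq (++-assoc E₁ (j ∷ E₂) _))
  = ⊥-elim (All≢-∉ E₁ (++⁻ʳ A₂ (++⁻ʳ E₂ Z≢)))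
... | inj₁ E≢ with split-at-first j A₂
...   | inj₁ A₂≢ = ⊥-elim (All≢-∉ α′ (subst (All (_≢ j)) (sym eq) (++⁺ E≢ (++⁺ A₂≢ E≢))))
...   | inj₂ (G , H , refl , G≢)
  with refl , refl ← first-occurrence-unique α′ (E ++ G) α′≢ (++⁺ E≢ G≢)
                       (trans eq (trans (cong (E ++_) (++-assoc G (j ∷ H) E)) (sym (++-assoc E G _))))
  = cong (_++ E) (H≡[] H head∉A₂) , trans (++-assoc E G [ j ]) (cong (λ h → E ++ G ++ j ∷ h) (sym (H≡[] H head∉A₂)))
  where
  H≡[] : ∀ H → (∀ {z Z′} → H ++ E ≡ z ∷ Z′ → All (_≢ z) (G ++ j ∷ H)) → H ≡ []
  H≡[] []      _ = refl
  H≡[] (h ∷ H) head∉ = ⊥-elim (All≢-∉ (G ++ [ j ]) (subst (All (_≢ h)) (sym (++-assoc G [ j ] (h ∷ H))) (head∉ refl)))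

record MaximalCommonPrefix (V P Q : Word) : Set where
  field
    {a b}   : ℕ
    {P′ Q′} : Word
    a≢b     : a ≢ b
    P≡      : P ≡ V ++ a ∷ P′
    Q≡      : Q ≡ V ++ b ∷ Q′

module _ {V P Q : Word} (mcp : MaximalCommonPrefix V P Q) where
  open MaximalCommonPrefix mcp

  mcp-++ʳ : ∀ T → MaximalCommonPrefix V P (Q ++ T)
  mcp-++ʳ T = record { a≢b = a≢b ; P≡ = P≡ ; Q≡ = trans (cong (_++ T) Q≡) (++-assoc V (b ∷ Q′) T) }

  mcp-⊕ : ∀ m → MaximalCommonPrefix (m ⊕ V) (m ⊕ P) (m ⊕ Q)
  mcp-⊕ m = record
    { a≢b = λ eq → a≢b (+-cancelˡ-≡ m _ _ eq)
    ; P≡  = trans (cong (m ⊕_) P≡) (⊕-++ m V (a ∷ P′))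
    ; Q≡  = trans (cong (m ⊕_) Q≡) (⊕-++ m V (b ∷ Q′))
    }

  mcp-length : ∀ E {S₁ S₂} → P ≡ E ++ S₁ → Q ≡ E ++ S₂ → length E ≤ length V
  mcp-length E P≡E Q≡E = length-commonPrefix-≤ E V (λ b≡a → a≢b (sym b≡a)) (trans (sym Q≡E) Q≡) (trans (sym P≡E) P≡)

  mcp-length-< : length V < length P
  mcp-length-< = subst (length V <_) (cong length (sym P≡)) (length-++-< V λ ())

  mcp-take : ∀ j → j ≤ length V → take j P ≡ take j Q
  mcp-take j j≤ = trans (cong (take j) P≡) (trans (take-++ˡ j V j≤) (sym (trans (cong (take j) Q≡) (take-++ˡ j V j≤))))

StraddlingSquareIn : Word → Word → Word → Set
StraddlingSquareIn Lw Rw S = (∃ λ B → S ≡ B ++ B) ×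
  (∃₂ λ A₁ A₂ → A₁ ≢ [] × A₂ ≢ [] × S ≡ A₁ ++ A₂ × IsSuffix A₁ Lw × IsPrefix A₂ Rw)

module Morphism (k : ℕ) .{{_ : NonZero k}} (k≥2 : 2 ≤ k) where

  Aligned : ℕ → Set
  Aligned x = x % k ≡ 0

  aligned-≡ : ∀ {a} → Aligned a → a ≡ (a / k) * k
  aligned-≡ {a} a≡ = trans (m≡m%n+[m/n]*n a k) (cong (_+ (a / k) * k) a≡)

  aligned-k* : ∀ q → Aligned (k * q)
  aligned-k* q = trans (cong (_% k) (*-comm k q)) (m*n%n≡0 q k)

  aligned-gap : ∀ {a b} → Aligned a → Aligned b → a < b → a + k ≤ b
  aligned-gap {a} {b} ka kb a<b = subst₂ _≤_ (trans (+-comm k _) (cong (_+ k) (sym (aligned-≡ ka)))) (sym (aligned-≡ kb))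
    (*-monoˡ-≤ k (*-cancelʳ-< k (a / k) (b / k) (subst₂ _<_ (aligned-≡ ka) (aligned-≡ kb) a<b)))

  aligned-0 : Aligned 0
  aligned-0 = m<n⇒m%n≡m (≤-trans (s≤s z≤n) k≥2)

  ¬aligned-suc : ∀ {a} → Aligned a → ¬ Aligned (suc a)
  ¬aligned-suc {a} ka ka+1 = <⇒≱ k≥2 (+-cancelˡ-≤ a k 1 (subst (a + k ≤_) (+-comm 1 a) (aligned-gap ka ka+1 (n<1+n a))))

  ¬aligned-1 : ¬ Aligned 1
  ¬aligned-1 = ¬aligned-suc aligned-0

  data Image (x : ℕ) : Set where
    long  : suc (x % k) < k → φ k x ≡ k * (x / k) ∷ suc x ∷ [] → Image x
    short : ¬ suc (x % k) < k → φ k x ≡ suc x ∷ [] → Image x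

  φ-long : ∀ x → suc (x % k) < k → φ k x ≡ k * (x / k) ∷ suc x ∷ []
  φ-long x lt with suc (x % k) <? k
  ... | yes _  = refl
  ... | no ¬lt = ⊥-elim (¬lt lt)

  φ-short : ∀ x → ¬ suc (x % k) < k → φ k x ≡ suc x ∷ []
  φ-short x ¬lt with suc (x % k) <? k
  ... | yes lt = ⊥-elim (¬lt lt)
  ... | no _   = refl

  image : ∀ x → Image x
  image x with suc (x % k) <? k
  ... | yes lt = long lt (φ-long x lt)
  ... | no ¬lt = short ¬lt (φ-short x ¬lt)

  long-¬aligned : ∀ x → suc (x % k) < k → ¬ Aligned (suc x)
  long-¬aligned x lt ka = 0≢1+n (trans (sym ka) (begin
    suc x % k                           ≡⟨ cong (λ y → suc y % k) (m≡m%n+[m/n]*n x k) ⟩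
    (suc (x % k) + (x / k) * k) % k     ≡⟨ [m+kn]%n≡m%n (suc (x % k)) (x / k) k ⟩
    suc (x % k) % k                     ≡⟨ m<n⇒m%n≡m lt ⟩
    suc (x % k)                         ∎))
    where open ≡-Reasoning

  short-aligned : ∀ x → ¬ suc (x % k) < k → Aligned (suc x)
  short-aligned x ¬lt = begin
    suc x % k                     ≡⟨ cong (λ y → suc y % k) (m≡m%n+[m/n]*n x k) ⟩
    (suc (x % k) + (x / k) * k) % k ≡⟨ cong (λ y → (y + (x / k) * k) % k) (≤-antisym (m%n<n x k) (≮⇒≥ ¬lt)) ⟩
    (k + (x / k) * k) % k         ≡⟨ [m+kn]%n≡m%n k (x / k) k ⟩
    k % k                         ≡⟨ n%n≡0 k ⟩
    0                             ∎
    where open ≡-Reasoning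

  blockStart-≤ : ∀ x → k * (x / k) ≤ x
  blockStart-≤ x = subst (_≤ x) (*-comm (x / k) k) (m/n*n≤m x k)

  long-< : ∀ x → suc (x % k) < k → suc x < k * (x / k) + k
  long-< x lt = begin-strict
    suc x                        ≡⟨ cong suc (m≡m%n+[m/n]*n x k) ⟩
    suc (x % k) + (x / k) * k    <⟨ +-monoˡ-< _ lt ⟩
    k + (x / k) * k              ≡⟨ cong₂ _+_ refl (*-comm (x / k) k) ⟩
    k + k * (x / k)              ≡⟨ +-comm k _ ⟩
    k * (x / k) + k              ∎
    where open ≤-Reasoning

  [k+x]%k≡x%k : ∀ x → (k + x) % k ≡ x % k
  [k+x]%k≡x%k x = trans (cong (_% k) (+-comm k x)) ([m+n]%n≡m%n x k)

  [k+x]/k≡1+x/k : ∀ x → (k + x) / k ≡ suc (x / k)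
  [k+x]/k≡1+x/k x = trans (m/n≡1+[m∸n]/n (m≤m+n k x)) (cong (λ y → suc (y / k)) (m+n∸m≡n k x))

  φ-0 : φ k 0 ≡ 0 ∷ 1 ∷ []
  φ-0 with image 0
  ... | long _ eq = trans eq (cong (λ q → q ∷ 1 ∷ []) (trans (cong (k *_) (0/n≡0 k)) (*-zeroʳ k)))
  ... | short ¬lt _ = ⊥-elim (¬lt (subst (λ r → suc r < k) (sym aligned-0) k≥2))

  φ-shift : ∀ x → φ k (k + x) ≡ k ⊕ φ k x
  φ-shift x with image x
  ... | long lt eq = begin
    φ k (k + x)                              ≡⟨ φ-long (k + x) (subst (λ r → suc r < k) (sym ([k+x]%k≡x%k x)) lt) ⟩
    k * ((k + x) / k) ∷ suc (k + x) ∷ []     ≡⟨ cong₂ (λ a b → a ∷ b ∷ []) (trans (cong (k *_) ([k+x]/k≡1+x/k x)) (*-suc k (x / k)))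
                                                     (sym (+-suc k x)) ⟩
    k ⊕ (k * (x / k) ∷ suc x ∷ [])           ≡⟨ cong (k ⊕_) eq ⟨
    k ⊕ φ k x                                ∎
    where open ≡-Reasoning
  ... | short ¬lt eq = begin
    φ k (k + x)          ≡⟨ φ-short (k + x) (subst (λ r → ¬ suc r < k) (sym ([k+x]%k≡x%k x)) ¬lt) ⟩
    suc (k + x) ∷ []     ≡⟨ cong [_] (sym (+-suc k x)) ⟩
    k ⊕ (suc x ∷ [])     ≡⟨ cong (k ⊕_) eq ⟨
    k ⊕ φ k x            ∎
    where open ≡-Reasoning

  φ*-++ : ∀ A B → φ* k (A ++ B) ≡ φ* k A ++ φ* k B
  φ*-++ = concatMap-++ (φ k)

  φ*-∷ʳ : ∀ A x → φ* k (A ∷ʳ x) ≡ φ* k A ++ φ k x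
  φ*-∷ʳ A x = trans (φ*-++ A [ x ]) (cong (φ* k A ++_) (++-identityʳ (φ k x)))

  φ*-shift : ∀ A → φ* k (k ⊕ A) ≡ k ⊕ φ* k A
  φ*-shift []      = refl
  φ*-shift (x ∷ A) = trans (cong₂ _++_ (φ-shift x) (φ*-shift A)) (sym (map-++ (k +_) (φ k x) (φ* k A)))

  φ-∷ʳ : ∀ x → ∃ λ P → φ k x ≡ P ∷ʳ suc x
  φ-∷ʳ x with image x
  ... | long _ eq  = [ k * (x / k) ] , eq
  ... | short _ eq = [] , eq

  φ-++≢[] : ∀ x {Q} → φ k x ++ Q ≢ []
  φ-++≢[] x with image x
  ... | long _ φx  rewrite φx = λ ()
  ... | short _ φx rewrite φx = λ ()

  φ*≡[] : ∀ A → φ* k A ≡ [] → A ≡ []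
  φ*≡[] []      _  = refl
  φ*≡[] (x ∷ A) eq = ⊥-elim (φ-++≢[] x eq)

  -- In φ* k w the aligned letters are exactly the first letters of the φ-images, so they mark image boundaries.
  AlignedHead : Word → Set
  AlignedHead S = ∀ {c r} → S ≡ c ∷ r → Aligned c

  φ-alignedHead : ∀ x {S} → AlignedHead (φ k x ++ S)
  φ-alignedHead x with image x
  ... | long _ φx    rewrite φx = λ { refl → aligned-k* (x / k) }
  ... | short ¬lt φx rewrite φx = λ { refl → short-aligned x ¬lt }

  φ*-alignedHead : ∀ A → AlignedHead (φ* k A)
  φ*-alignedHead []      ()
  φ*-alignedHead (x ∷ A) = φ-alignedHead x

  φ-inner-¬aligned : ∀ x p P {c E} → φ k x ≡ (p ∷ P) ++ c ∷ E → ¬ Aligned c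
  φ-inner-¬aligned x p [] eq with image x
  ... | long lt φx with refl ← trans (sym φx) eq = long-¬aligned x lt
  ... | short _ φx = ⊥-elim ([]≢++∷ [] (∷-injectiveʳ (trans (sym φx) eq)))
  φ-inner-¬aligned x p (q ∷ P) eq with image x
  ... | long _ φx  = ⊥-elim ([]≢++∷ P (∷-injectiveʳ (∷-injectiveʳ (trans (sym φx) eq))))
  ... | short _ φx = ⊥-elim ([]≢++∷ (q ∷ P) (∷-injectiveʳ (trans (sym φx) eq)))

  φ*-split : ∀ w P {S} → AlignedHead S → φ* k w ≡ P ++ S →
    ∃₂ λ w₁ w₂ → w ≡ w₁ ++ w₂ × φ* k w₁ ≡ P × φ* k w₂ ≡ S
  φ*-split w       []      kS eq = [] , w , refl , refl , eq
  φ*-split []      (_ ∷ _) kS ()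
  φ*-split (x ∷ w) (p ∷ P) kS eq with ++-equidivisible (φ k x) (p ∷ P) eq
  ... | inj₁ (E , P≡ , eq′) with w₁ , w₂ , refl , φw₁ , φw₂ ← φ*-split w E kS eq′
    = x ∷ w₁ , w₂ , refl , trans (cong (φ k x ++_) φw₁) (sym P≡) , φw₂
  ... | inj₂ ([] , φx , eq′) = [ x ] , w , refl , trans (++-identityʳ (φ k x)) (trans φx (++-identityʳ _)) , sym eq′
  ... | inj₂ (_ ∷ _ , φx , eq′) = ⊥-elim (φ-inner-¬aligned x p P φx (kS eq′))

  φ*-∷ʳ⁻ : ∀ w {P x} → φ* k w ≡ P ∷ʳ x → ∃₂ λ w₀ y → w ≡ w₀ ∷ʳ y × x ≡ suc y
  φ*-∷ʳ⁻ w {P} {x} eq with initLast w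
  ... | []       = ⊥-elim ([]≢++∷ P eq)
  ... | w₀ ∷ʳ′ y with P′ , φy ← φ-∷ʳ y = w₀ , y , refl , sym (∷ʳ-injectiveʳ (φ* k w₀ ++ P′) P (begin
    (φ* k w₀ ++ P′) ∷ʳ suc y   ≡⟨ ++-assoc (φ* k w₀) P′ _ ⟩
    φ* k w₀ ++ P′ ∷ʳ suc y     ≡⟨ cong (φ* k w₀ ++_) φy ⟨
    φ* k w₀ ++ φ k y           ≡⟨ φ*-∷ʳ w₀ y ⟨
    φ* k (w₀ ∷ʳ y)             ≡⟨ eq ⟩
    P ∷ʳ x                     ∎))
    where open ≡-Reasoning

  φ*-boundary : ∀ w P {x S} → AlignedHead S → φ* k w ≡ P ++ x ∷ S →
    ∃₂ λ w₀ y → ∃ λ w₂ → w ≡ w₀ ++ y ∷ w₂ × x ≡ suc y × φ* k w₂ ≡ S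
  φ*-boundary w P {x} kS eq with w₁ , w₂ , refl , φw₁ , φw₂ ← φ*-split w (P ∷ʳ x) kS (trans eq (sym (++-assoc P [ x ] _)))
    with w₀ , y , refl , x≡ ← φ*-∷ʳ⁻ w₁ φw₁ = w₀ , y , w₂ , ++-assoc w₀ [ y ] w₂ , x≡ , φw₂

  φ-cancelˡ : ∀ z t {S Q} → AlignedHead S → φ k z ++ S ≡ φ k t ++ Q → z ≡ t ⊎ (Aligned (suc t) × suc t ≤ z)
  φ-cancelˡ z t kS eq with image z | image t
  ... | long _ φz | long _ φt rewrite φz | φt = inj₁ (suc-injective (∷-injectiveˡ (∷-injectiveʳ eq)))
  ... | short _ φz | short _ φt rewrite φz | φt = inj₁ (suc-injective (∷-injectiveˡ eq))
  ... | short _ φz | long lt φt rewrite φz | φt = ⊥-elim (long-¬aligned t lt (kS (∷-injectiveʳ eq)))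
  ... | long _ φz | short ¬lt φt rewrite φz | φt =
    inj₂ (short-aligned t ¬lt , subst (_≤ z) (∷-injectiveˡ eq) (blockStart-≤ z))

  φ-cancel : ∀ x y {S T} → AlignedHead S → AlignedHead T → φ k x ++ S ≡ φ k y ++ T → x ≡ y × S ≡ T
  φ-cancel x y kS kT eq with φ-cancelˡ x y kS eq | φ-cancelˡ y x kT (sym eq)
  ... | inj₁ refl        | _              = refl , ++-cancelˡ (φ k x) _ _ eq
  ... | inj₂ (_ , y<x)   | inj₁ refl      = ⊥-elim (<-irrefl refl y<x)
  ... | inj₂ (_ , y<x)   | inj₂ (_ , x<y) = ⊥-elim (<-asym y<x x<y)

  φ*-injective : ∀ A B → φ* k A ≡ φ* k B → A ≡ B
  φ*-injective []      B       eq = sym (φ*≡[] B (sym eq))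
  φ*-injective (x ∷ A) []      eq = φ*≡[] (x ∷ A) eq
  φ*-injective (x ∷ A) (y ∷ B) eq with refl , eq′ ← φ-cancel x y (φ*-alignedHead A) (φ*-alignedHead B) eq
    = cong (x ∷_) (φ*-injective A B eq′)

module Words (k₂ : ℕ) where

  k k₁ : ℕ
  k  = 2 + k₂
  k₁ = 1 + k₂

  open Morphism k (s≤s (s≤s z≤n)) public
  open ≡-Reasoning

  W-head : ∀ s → ∃ λ r → W k s ≡ 0 ∷ r
  W-head zero    = [] , refl
  W-head (suc s) with r , eq ← W-head s = 1 ∷ φ* k r , trans (cong (φ* k) eq) (cong (_++ φ* k r) φ-0)

  φ*-All< : ∀ {s} A → All (_< s) A → All (_< suc s) (φ* k A)
  φ*-All< []      []       = []
  φ*-All< (x ∷ A) (x<s ∷ pA) with image x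
  ... | long _ φx  rewrite φx = s≤s (≤-trans (blockStart-≤ x) (<⇒≤ x<s)) ∷ s≤s x<s ∷ φ*-All< A pA
  ... | short _ φx rewrite φx = s≤s x<s ∷ φ*-All< A pA

  W-suc : ∀ {s I} → W k s ≡ I ∷ʳ s → W k (suc s) ≡ φ* k I ++ φ k s
  W-suc {s} {I} eq = trans (cong (φ* k) eq) (φ*-∷ʳ I s)

  W-last : ∀ s → ∃ λ I → W k s ≡ I ∷ʳ s × All (_< s) I
  W-last zero = [] , refl , []
  W-last (suc s) with I , eq , I<s ← W-last s | image s
  ... | long _ φs  = φ* k I ∷ʳ k * (s / k) ,
                     trans (W-suc eq) (trans (cong (φ* k I ++_) φs) (sym (++-assoc (φ* k I) _ _))) ,
                     ++⁺ (φ*-All< I I<s) (s≤s (blockStart-≤ s) ∷ [])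
  ... | short _ φs = φ* k I , trans (W-suc eq) (cong (φ* k I ++_) φs) , φ*-All< I I<s

  BoundedStep : ℕ → ℕ → Set
  BoundedStep x y = y < x + k

  φ-steps-++ : ∀ x {B} → Connected BoundedStep (just (suc x)) (head B) → Linked BoundedStep B →
    Linked BoundedStep (φ k x ++ B)
  φ-steps-++ x c lB with image x
  ... | long lt φx  rewrite φx = long-< x lt ∷ (c ∷′ lB)
  ... | short _ φx rewrite φx = c ∷′ lB

  φ*-steps : ∀ w → Linked BoundedStep w → Linked BoundedStep (φ* k w)
  φ*-steps []            _            = []
  φ*-steps (x ∷ [])      _            = φ-steps-++ x just-nothing []
  φ*-steps (x ∷ y ∷ r)   (y<x+k ∷ lw) = φ-steps-++ x (step (φ* k r)) (φ*-steps (y ∷ r) lw)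
    where
    step : ∀ S → Connected BoundedStep (just (suc x)) (head (φ k y ++ S))
    step S with image y
    ... | long _ φy  rewrite φy = just (s≤s (≤-trans (blockStart-≤ y) (<⇒≤ y<x+k)))
    ... | short _ φy rewrite φy = just (s≤s y<x+k)

  W-steps : ∀ s → Linked BoundedStep (W k s)
  W-steps zero    = [-]
  W-steps (suc s) = φ*-steps (W k s) (W-steps s)

  W-suffix-∷ʳ : ∀ s F A → W k s ≡ F ++ A → A ≢ [] → ∃ λ A′ → A ≡ A′ ∷ʳ s × All (_< s) A′
  W-suffix-∷ʳ s F A eq A≢[] with I , Ws , I<s ← W-last s
    with A′ , A≡ , I≡ ← suffix-∷ʳ F A I (trans (sym Ws) eq) A≢[] = A′ , A≡ , ++⁻ʳ F (subst (All (_< s)) I≡ I<s)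

  W-alignedHead : ∀ s {Q} → AlignedHead (W k s ++ Q)
  W-alignedHead s with r , Ws ← W-head s rewrite Ws = λ { refl → aligned-0 }

  W-before-last : ∀ t → Aligned (suc t) → ∃₂ λ I g → W k t ≡ (I ∷ʳ g) ∷ʳ t × Aligned g × g < t
  W-before-last zero    a1 = ⊥-elim (¬aligned-1 a1)
  W-before-last (suc s) a2+s with I , eq , _ ← W-last s | image s
  ... | long _ φs  = φ* k I , k * (s / k) , trans (W-suc eq) (trans (cong (φ* k I ++_) φs) (sym (++-assoc (φ* k I) _ _))) ,
                     aligned-k* (s / k) , s≤s (blockStart-≤ s)
  ... | short ¬lt _ = ⊥-elim (¬aligned-suc {suc s} (short-aligned s ¬lt) a2+s)

  -- Aligned letters mark the boundaries of φ-images, so an occurrence of x W_{t+1} in W_{i+1} comes from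
  -- one of y W_t in W_i with x = y + 1; the alternative left by φ-cancelˡ breaks the bounded steps of W.
  t<letter-before-W : ∀ i t x P Q → W k i ≡ P ++ x ∷ W k t ++ Q → t < x
  t<letter-before-W zero t x P Q eq with r , Wt ← W-head t rewrite Wt with P
  ... | []    = ⊥-elim ([]≢++∷ [] (∷-injectiveʳ eq))
  ... | _ ∷ P′ = ⊥-elim ([]≢++∷ P′ (∷-injectiveʳ eq))
  t<letter-before-W (suc i) zero x P Q eq with _ , _ , _ , _ , refl , _ ← φ*-boundary (W k i) P (W-alignedHead 0) eq = s≤s z≤n
  t<letter-before-W (suc i) (suc t) x P Q eq
    with w₀ , y , w₂ , Wi , refl , φw₂ ← φ*-boundary (W k i) P (W-alignedHead (suc t)) eq
    with I , Wt , _ ← W-last t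
    with a , b , w₂≡ , φa , φb ← φ*-split w₂ (φ* k I) (φ-alignedHead t)
                                   (trans φw₂ (trans (cong (_++ Q) (W-suc Wt)) (++-assoc (φ* k I) (φ k t) Q)))
    with a≡I ← φ*-injective a I φa
    with b | φb | w₂≡
  ... | []     | φb | _   = ⊥-elim (φ-++≢[] t (sym φb))
  ... | z ∷ b′ | φb | w₂≡ with φ-cancelˡ z t (φ*-alignedHead b′) φb
  ...   | inj₁ refl = s≤s (t<letter-before-W i t y w₀ b′ Wi′)
    where
    Wi′ : W k i ≡ w₀ ++ y ∷ W k t ++ b′
    Wi′ = begin
      W k i                      ≡⟨ trans Wi (cong (λ u → w₀ ++ y ∷ u) w₂≡) ⟩
      w₀ ++ y ∷ a ++ t ∷ b′      ≡⟨ cong (λ u → w₀ ++ y ∷ u ++ t ∷ b′) a≡I ⟩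
      w₀ ++ y ∷ I ++ t ∷ b′      ≡⟨ cong (λ u → w₀ ++ y ∷ u) (++-assoc I [ t ] b′) ⟨
      w₀ ++ y ∷ (I ∷ʳ t) ++ b′   ≡⟨ cong (λ u → w₀ ++ y ∷ u ++ b′) Wt ⟨
      w₀ ++ y ∷ W k t ++ b′      ∎
  ...   | inj₂ (kt , t<z) with I′ , g , Wt′ , kg , g<t ← W-before-last t kt =
    ⊥-elim (<⇒≱ z<g+k (≤-trans (aligned-gap kg kt (m<n⇒m<1+n g<t)) t<z))
    where
    Wi′ : W k i ≡ (w₀ ++ y ∷ I′) ++ g ∷ z ∷ b′
    Wi′ = begin
      W k i                              ≡⟨ trans Wi (cong (λ u → w₀ ++ y ∷ u) w₂≡) ⟩
      w₀ ++ y ∷ a ++ z ∷ b′              ≡⟨ cong (λ u → w₀ ++ y ∷ u ++ z ∷ b′)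
                                              (trans a≡I (∷ʳ-injectiveˡ I (I′ ∷ʳ g) (trans (sym Wt) Wt′))) ⟩
      w₀ ++ y ∷ (I′ ∷ʳ g) ++ z ∷ b′      ≡⟨ cong (λ u → w₀ ++ y ∷ u) (++-assoc I′ [ g ] _) ⟩
      w₀ ++ (y ∷ I′) ++ g ∷ z ∷ b′       ≡⟨ ++-assoc w₀ (y ∷ I′) _ ⟨
      (w₀ ++ y ∷ I′) ++ g ∷ z ∷ b′       ∎
    z<g+k : z < g + k
    z<g+k = Linked-middle (w₀ ++ y ∷ I′) (subst (Linked BoundedStep) Wi′ (W-steps i))

  Wrange-+ : ∀ top a b → Wrange k top (a + b) ≡ Wrange k top a ++ Wrange k (top ∸ a) b
  Wrange-+ top zero    b = refl
  Wrange-+ top (suc a) b = begin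
    W k top ++ Wrange k (top ∸ 1) (a + b)                               ≡⟨ cong (W k top ++_) (Wrange-+ (top ∸ 1) a b) ⟩
    W k top ++ Wrange k (top ∸ 1) a ++ Wrange k (top ∸ 1 ∸ a) b         ≡⟨ cong (λ m → W k top ++ Wrange k (top ∸ 1) a ++ Wrange k m b)
                                                                               (∸-+-assoc top 1 a) ⟩
    W k top ++ Wrange k (top ∸ 1) a ++ Wrange k (top ∸ suc a) b         ≡⟨ ++-assoc (W k top) _ _ ⟨
    (W k top ++ Wrange k (top ∸ 1) a) ++ Wrange k (top ∸ suc a) b       ∎

  Wrange-∷ʳ : ∀ top l → Wrange k top (suc l) ≡ Wrange k top l ++ W k (top ∸ l)
  Wrange-∷ʳ top l = begin
    Wrange k top (suc l)                      ≡⟨ cong (Wrange k top) (+-comm 1 l) ⟩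
    Wrange k top (l + 1)                      ≡⟨ Wrange-+ top l 1 ⟩
    Wrange k top l ++ W k (top ∸ l) ++ []     ≡⟨ cong (Wrange k top l ++_) (++-identityʳ _) ⟩
    Wrange k top l ++ W k (top ∸ l)           ∎

  φ*-Wrange : ∀ top l → l ≤ suc top → φ* k (Wrange k top l) ≡ Wrange k (suc top) l
  φ*-Wrange top       zero          _ = refl
  φ*-Wrange top       (suc zero)    _ = φ*-++ (W k top) []
  φ*-Wrange (suc top) (suc (suc l)) (s≤s l≤) =
    trans (φ*-++ (W k (suc top)) (Wrange k top (suc l))) (cong (W k (suc (suc top)) ++_) (φ*-Wrange top (suc l) l≤))

  W-small : ∀ s → suc (suc s) ≤ k → W k (suc s) ≡ Wrange k s (suc s) ∷ʳ suc s
  W-small zero    _  = trans (++-identityʳ (φ k 0)) φ-0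
  W-small (suc s) s+3≤k = begin
    φ* k (W k (suc s))                                   ≡⟨ cong (φ* k) (W-small s (≤-trans (n≤1+n _) s+3≤k)) ⟩
    φ* k (Wrange k s (suc s) ∷ʳ suc s)                   ≡⟨ φ*-∷ʳ (Wrange k s (suc s)) (suc s) ⟩
    φ* k (Wrange k s (suc s)) ++ φ k (suc s)             ≡⟨ cong₂ _++_ (φ*-Wrange s (suc s) ≤-refl) φ-1+s ⟩
    Wrange k (suc s) (suc s) ++ 0 ∷ suc (suc s) ∷ []     ≡⟨ ++-assoc (Wrange k (suc s) (suc s)) [ 0 ] _ ⟨
    (Wrange k (suc s) (suc s) ++ W k 0) ∷ʳ suc (suc s)   ≡⟨ cong (λ w → (Wrange k (suc s) (suc s) ++ W k w) ∷ʳ suc (suc s))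
                                                                  (n∸n≡0 (suc s)) ⟨
    (Wrange k (suc s) (suc s) ++ W k (suc s ∸ suc s)) ∷ʳ suc (suc s) ≡⟨ cong (_∷ʳ suc (suc s)) (Wrange-∷ʳ (suc s) (suc s)) ⟨
    Wrange k (suc s) (suc (suc s)) ∷ʳ suc (suc s)        ∎
    where
    s+1<k : suc s < k
    s+1<k = ≤-trans (n≤1+n _) s+3≤k
    φ-1+s : φ k (suc s) ≡ 0 ∷ suc (suc s) ∷ []
    φ-1+s = trans (φ-long (suc s) (subst (λ r → suc r < k) (sym (m<n⇒m%n≡m s+1<k)) s+3≤k))
                  (cong (λ q → q ∷ suc (suc s) ∷ []) (trans (cong (k *_) (m<n⇒m/n≡0 s+1<k)) (*-zeroʳ k)))

  φ-k₁ : φ k k₁ ≡ [ k ]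
  φ-k₁ = φ-short k₁ (λ lt → <-irrefl refl (subst (λ r → suc r < k) (m<n⇒m%n≡m ≤-refl) lt))

  W-recurrence : ∀ d → W k (k + d) ≡ Wrange k (k₁ + d) k₁ ++ k ⊕ W k d
  W-recurrence zero = begin
    W k (k + 0)                           ≡⟨ cong (W k) (+-identityʳ k) ⟩
    φ* k (W k k₁)                         ≡⟨ cong (φ* k) (W-small k₂ ≤-refl) ⟩
    φ* k (Wrange k k₂ k₁ ∷ʳ k₁)           ≡⟨ φ*-∷ʳ (Wrange k k₂ k₁) k₁ ⟩
    φ* k (Wrange k k₂ k₁) ++ φ k k₁       ≡⟨ cong₂ _++_ (φ*-Wrange k₂ k₁ ≤-refl) φ-k₁ ⟩
    Wrange k k₁ k₁ ++ [ k ]               ≡⟨ cong₂ (λ a b → Wrange k a k₁ ++ [ b ]) (+-identityʳ k₁) (+-identityʳ k) ⟨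
    Wrange k (k₁ + 0) k₁ ++ k ⊕ W k 0     ∎
  W-recurrence (suc d) = begin
    W k (k + suc d)                                       ≡⟨ cong (W k) (+-suc k d) ⟩
    φ* k (W k (k + d))                                    ≡⟨ cong (φ* k) (W-recurrence d) ⟩
    φ* k (Wrange k (k₁ + d) k₁ ++ k ⊕ W k d)              ≡⟨ φ*-++ (Wrange k (k₁ + d) k₁) _ ⟩
    φ* k (Wrange k (k₁ + d) k₁) ++ φ* k (k ⊕ W k d)       ≡⟨ cong₂ _++_ (φ*-Wrange (k₁ + d) k₁ (≤-trans (m≤m+n k₁ d) (n≤1+n _)))
                                                                         (φ*-shift (W k d)) ⟩
    Wrange k (suc (k₁ + d)) k₁ ++ k ⊕ W k (suc d)         ≡⟨ cong (λ m → Wrange k m k₁ ++ k ⊕ W k (suc d)) (+-suc k₁ d) ⟨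
    Wrange k (k₁ + suc d) k₁ ++ k ⊕ W k (suc d)           ∎

  W-prefix : ∀ a d → ∃ λ R → W k (a + d) ≡ W k a ++ R
  W-prefix zero    d with r , Wd ← W-head d = r , Wd
  W-prefix (suc a) d with R , eq ← W-prefix a d = φ* k R , trans (cong (φ* k) eq) (φ*-++ (W k a) R)

  W-All≤ : ∀ s → All (_≤ s) (W k s)
  W-All≤ s with I , eq , I<s ← W-last s = subst (All (_≤ s)) (sym eq) (++⁺ (All.map <⇒≤ I<s) (≤-refl ∷ []))

  Wrange-All≤ : ∀ top l → All (_≤ top) (Wrange k top l)
  Wrange-All≤ top zero    = []
  Wrange-All≤ top (suc l) = ++⁺ (W-All≤ top) (All.map (λ x≤ → ≤-trans x≤ (m∸n≤m top 1)) (Wrange-All≤ (top ∸ 1) l))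

  Wrange-≢[]⇒0< : ∀ top l → Wrange k top l ≢ [] → 0 < l
  Wrange-≢[]⇒0< top zero    ≢[] = ⊥-elim (≢[] refl)
  Wrange-≢[]⇒0< top (suc l) _   = s≤s z≤n

  Wrange-head : ∀ top l {x δ} → Wrange k top l ≡ x ∷ δ → x ≡ 0
  Wrange-head top zero    ()
  Wrange-head top (suc l) eq with r , Wtop ← W-head top =
    sym (∷-injectiveˡ (trans (sym (cong (_++ Wrange k (top ∸ 1) l) Wtop)) eq))

  Wrange-last : ∀ top l → ∃ λ I → Wrange k top (suc l) ≡ I ∷ʳ (top ∸ l)
  Wrange-last top l with I , eq , _ ← W-last (top ∸ l) =
    Wrange k top l ++ I , trans (Wrange-∷ʳ top l) (trans (cong (Wrange k top l ++_) eq) (sym (++-assoc (Wrange k top l) I _)))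

  W-firstOccurrence : ∀ a b P {Y} → a ≤ b → W k b ≡ (P ∷ʳ a) ++ Y → All (_< a) P → P ∷ʳ a ≡ W k a
  W-firstOccurrence a b P {Y} a≤b eq P<a with R , Wb ← W-prefix a (b ∸ a) | I , Wa , I<a ← W-last a
    with refl , _ ← first-occurrence-unique P I (All.map <⇒≢ P<a) (All.map <⇒≢ I<a) (begin
      P ++ a ∷ Y                ≡⟨ ++-assoc P [ a ] Y ⟨
      (P ∷ʳ a) ++ Y             ≡⟨ eq ⟨
      W k b                     ≡⟨ cong (W k) (m+[n∸m]≡n a≤b) ⟨
      W k (a + (b ∸ a))         ≡⟨ Wb ⟩
      W k a ++ R                ≡⟨ cong (_++ R) Wa ⟩
      (I ∷ʳ a) ++ R             ≡⟨ ++-assoc I [ a ] R ⟩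
      I ++ a ∷ R                ∎) = sym Wa

  StartsInBlock : ℕ → ℕ → Word → Set
  StartsInBlock top len A = ∃₂ λ i α₀ → ∃ λ α →
    i < len × W k (top ∸ i) ≡ α₀ ++ α × α ≢ [] × A ≡ α ++ Wrange k (top ∸ i ∸ 1) (len ∸ suc i)

  Wrange-suffix : ∀ top len Pf A → Wrange k top len ≡ Pf ++ A → A ≢ [] → StartsInBlock top len A
  Wrange-suffix top zero    Pf A eq A≢[] = ⊥-elim (A≢[] (++-conicalʳ Pf A (sym eq)))
  Wrange-suffix top (suc l) Pf A eq A≢[] = cases (++-equidivisible (W k top) Pf eq)
    where
    later : ∀ E → Wrange k (top ∸ 1) l ≡ E ++ A → StartsInBlock top (suc l) A
    later E eq′ with i , α₀ , α , i< , Wi , α≢[] , A≡ ← Wrange-suffix (top ∸ 1) l E A eq′ A≢[] =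
      suc i , α₀ , α , s≤s i< , trans (cong (W k) (sym (∸-+-assoc top 1 i))) Wi , α≢[] ,
      trans A≡ (cong (λ m → α ++ Wrange k (m ∸ 1) (l ∸ suc i)) (∸-+-assoc top 1 i))
    cases : (∃ λ E → Pf ≡ W k top ++ E × Wrange k (top ∸ 1) l ≡ E ++ A)
          ⊎ (∃ λ E → W k top ≡ Pf ++ E × A ≡ E ++ Wrange k (top ∸ 1) l) → StartsInBlock top (suc l) A
    cases (inj₁ (E , _ , eq′))          = later E eq′
    cases (inj₂ ([] , _ , A≡))          = later [] (sym A≡)
    cases (inj₂ (x ∷ E , Wtop , A≡))    = 0 , Pf , x ∷ E , s≤s z≤n , Wtop , (λ ()) , A≡

  ⊕W-firstOccurrence : ∀ m d b A {Y} G → d ≤ b → m ⊕ W k b ≡ A ++ Y → A ≡ G ∷ʳ (m + d) → All (_< m + d) G → A ≡ m ⊕ W k d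
  ⊕W-firstOccurrence m d b A G d≤b eq A≡ G< with P , Q , Wb , mP , _ ← map-++⁻ (m +_) (W k b) A eq | initLast P
  ... | [] = ⊥-elim ([]≢++∷ G (trans mP A≡))
  ... | P′ ∷ʳ′ x with G≡ , m+x≡ ← ∷ʳ-injective (m ⊕ P′) G (trans (sym (⊕-++ m P′ [ x ])) (trans mP A≡)) = begin
    A                    ≡⟨ mP ⟨
    m ⊕ (P′ ∷ʳ x)        ≡⟨ cong (λ y → m ⊕ (P′ ∷ʳ y)) x≡d ⟩
    m ⊕ (P′ ∷ʳ d)        ≡⟨ cong (m ⊕_) (W-firstOccurrence d b P′ d≤b
                                (trans Wb (cong (λ y → (P′ ∷ʳ y) ++ Q) x≡d)) P′<d) ⟩
    m ⊕ W k d            ∎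
    where
    x≡d : x ≡ d
    x≡d = +-cancelˡ-≡ m x d m+x≡
    P′<d : All (_< d) P′
    P′<d = All.map (+-cancelˡ-< m _ d) (map⁻ (subst (All (_< m + d)) (sym G≡) G<))

  Wrange-¬suffix : ∀ top r s α₀ → r < top → Wrange k top (suc r + suc s) ≢ α₀ ++ Wrange k top (suc r)
  Wrange-¬suffix top r s α₀ r<top eq with I , Zr ← Wrange-last top r | I′ , T≡ ← Wrange-last (top ∸ suc r) s =
    <-irrefl last≡ (≤-<-trans (m∸n≤m (top ∸ suc r) s) (∸-monoʳ-< (n<1+n r) r<top))
    where
    last≡ : top ∸ suc r ∸ s ≡ top ∸ r
    last≡ = ∷ʳ-injectiveʳ (Wrange k top (suc r) ++ I′) (α₀ ++ I) (begin
      (Wrange k top (suc r) ++ I′) ∷ʳ (top ∸ suc r ∸ s)   ≡⟨ ++-assoc (Wrange k top (suc r)) I′ _ ⟩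
      Wrange k top (suc r) ++ I′ ∷ʳ (top ∸ suc r ∸ s)     ≡⟨ cong (Wrange k top (suc r) ++_) T≡ ⟨
      Wrange k top (suc r) ++ Wrange k (top ∸ suc r) (suc s) ≡⟨ Wrange-+ top (suc r) (suc s) ⟨
      Wrange k top (suc r + suc s)                       ≡⟨ eq ⟩
      α₀ ++ Wrange k top (suc r)                         ≡⟨ cong (α₀ ++_) Zr ⟩
      α₀ ++ I ∷ʳ (top ∸ r)                               ≡⟨ ++-assoc α₀ I _ ⟨
      (α₀ ++ I) ∷ʳ (top ∸ r)                             ∎)

-- k = 2 + k₂, with 2 * k ∸ 1 and 3 * k ∸ 2 in the normal forms they reduce to.
private
  index-from-bound : ∀ k₂ o → suc (suc (k₂ + (2 + k₂ + 0))) + o ≡ suc k₂ + (2 + k₂ + suc o)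
  index-from-bound = solve-∀

  index-right : ∀ k₂ t → suc k₂ + (2 + k₂ + suc t) ≡ (suc k₂ + suc t) + (2 + k₂)
  index-right = solve-∀

  index-U : ∀ k₂ t → suc k₂ + (2 + k₂ + suc t) + 1 ≡ suc t + 2 * (2 + k₂)
  index-U = solve-∀

  index-V : ∀ k₂ t → suc k₂ + (2 + k₂ + suc t) ≡ t + 2 * (2 + k₂)
  index-V = solve-∀

  index-3k-left : ∀ k₂ t → suc (suc k₂ + (2 + k₂ + suc t)) ≡ (k₂ + (2 + k₂)) + suc (suc (suc t))
  index-3k-left = solve-∀

  index-3k-n : ∀ k₂ t → suc k₂ + (2 + k₂ + suc t) ≡ (k₂ + (2 + k₂)) + suc (suc t)
  index-3k-n = solve-∀

  index-3k-right : ∀ k₂ → k₂ + (2 + k₂ + (2 + k₂ + 0)) ≡ (k₂ + (2 + k₂)) + (2 + k₂)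
  index-3k-right = solve-∀

module Squares (k₂ : ℕ) where
  open Words k₂ public
  open ≡-Reasoning

  -- For n = k₁ + (k + t): L t = leftPart k n, R t = rightPart k n and U t = k ⊕ W k (n + 1 ∸ 2 * k).
  L R U : ℕ → Word
  L t = Wrange k (k₂ + (k + t)) k₁
  R t = k ⊕ W k (k₁ + t)
  U t = k ⊕ W k t

  LongestRepeatedPrefix : ℕ → Word → Set
  LongestRepeatedPrefix t V = ∃ λ Q → W k (suc t) ≡ W k t ++ Q × MaximalCommonPrefix V (W k t) Q

  L-last : ∀ t → ∃ λ X → L t ≡ X ++ W k (k + t)
  L-last t = Wrange k (k₂ + (k + t)) k₂ ,
    trans (Wrange-∷ʳ (k₂ + (k + t)) k₂) (cong (λ s → Wrange k (k₂ + (k + t)) k₂ ++ W k s) (m+n∸m≡n k₂ (k + t)))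

  U≢[] : ∀ t → U t ≢ []
  U≢[] t eq with r , Wt ← W-head t with () ← trans (sym (cong (k ⊕_) Wt)) eq

  L-ends-with-U : ∀ t → ∃ λ X → L t ≡ X ++ U t
  L-ends-with-U t with X , Lt ← L-last t =
    X ++ Wrange k (k₁ + t) k₁ , trans Lt (trans (cong (X ++_) (W-recurrence t)) (sym (++-assoc X _ (U t))))

  length-R<length-W : ∀ t → length (R t) < length (W k (k + t))
  length-R<length-W t = subst₂ _<_ (sym (length-⊕ k (W k (k₁ + t)))) (cong length (sym W≡))
    (length-++-< (W k (k₁ + t)) (λ eq → U≢[] t (++-conicalʳ _ (U t) eq)))
    where
    W≡ : W k (k + t) ≡ W k (k₁ + t) ++ Wrange k (k₂ + t) k₂ ++ U t
    W≡ = trans (W-recurrence t) (++-assoc (W k (k₁ + t)) _ (U t))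

  U-last : ∀ t → ∃ λ I → U t ≡ I ∷ʳ (k + t) × All (_< k + t) I
  U-last t with I , Wt , I<t ← W-last t =
    k ⊕ I , trans (cong (k ⊕_) Wt) (⊕-++ k I [ t ]) , map⁺ (All.map (+-monoʳ-< k) I<t)

  R-¬factor : ∀ t P {Q} → R t ≢ P ++ (k + t) ∷ U t ++ Q
  R-¬factor t P eq with P′ , Q′ , Wk₁+t ← ⊕-factor⁻ k (W k (k₁ + t)) (t ∷ W k t) P eq =
    <-irrefl refl (t<letter-before-W (k₁ + t) t t P′ Q′ Wk₁+t)

  R-after-U : ∀ {t V} → LongestRepeatedPrefix t V → ∃ λ R₁ → R t ≡ U t ++ R₁ × MaximalCommonPrefix (k ⊕ V) (U t) R₁
  R-after-U {t} (Q , W1+t , mcp) with Rest , Wk₁+t ← W-prefix (suc t) k₂ =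
    k ⊕ (Q ++ Rest) , R≡ , mcp-⊕ (mcp-++ʳ mcp Rest) k
    where
    R≡ : R t ≡ U t ++ k ⊕ (Q ++ Rest)
    R≡ = begin
      k ⊕ W k (k₁ + t)             ≡⟨ cong (λ s → k ⊕ W k (suc s)) (+-comm k₂ t) ⟩
      k ⊕ W k (suc t + k₂)         ≡⟨ cong (k ⊕_) Wk₁+t ⟩
      k ⊕ (W k (suc t) ++ Rest)    ≡⟨ cong (λ w → k ⊕ (w ++ Rest)) W1+t ⟩
      k ⊕ ((W k t ++ Q) ++ Rest)   ≡⟨ cong (k ⊕_) (++-assoc (W k t) Q Rest) ⟩
      k ⊕ (W k t ++ Q ++ Rest)     ≡⟨ ⊕-++ k (W k t) (Q ++ Rest) ⟩
      U t ++ k ⊕ (Q ++ Rest)       ∎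

  L-suffix-∷ʳ : ∀ t Xs A₁ → L t ≡ Xs ++ A₁ → A₁ ≢ [] → length A₁ ≤ length (R t) →
    ∃ λ A₁′ → A₁ ≡ A₁′ ∷ʳ (k + t) × All (_< k + t) A₁′
  L-suffix-∷ʳ t Xs A₁ Ls A₁≢[] |A₁|≤ with X , Lt ← L-last t with ++-equidivisible Xs X (trans (sym Ls) Lt)
  ... | inj₂ (F , _ , Wk+t) = W-suffix-∷ʳ (k + t) F A₁ Wk+t A₁≢[]
  ... | inj₁ (F , _ , A₁≡) = ⊥-elim (<⇒≱ (length-R<length-W t)
    (≤-trans (length-++-≤ʳ (W k (k + t)) {F}) (≤-trans (≤-reflexive (cong length (sym A₁≡))) |A₁|≤)))

  U-prefix-of-R : ∀ t A₁′ E {Ys R₁} → All (_< k + t) A₁′ → R t ≡ U t ++ R₁ → R t ≡ E ++ (A₁′ ∷ʳ (k + t)) ++ E ++ Ys →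
    U t ≡ E ++ A₁′ ∷ʳ (k + t) × R₁ ≡ E ++ Ys
  U-prefix-of-R t A₁′ E {Ys} {R₁} A₁′< R≡ Rs
    with IU , U≡ , IU< ← U-last t
    with R≡′ ← trans R≡ (trans (cong (_++ R₁) U≡) (++-assoc IU [ k + t ] R₁))
    with Rs′ ← trans Rs (++-∷ʳ-++ E A₁′ (E ++ Ys))
    with split-at-first (k + t) E
  ... | inj₁ E≢ with E++A₁′≡ , R₁≡ ← first-occurrence-unique (E ++ A₁′) IU (++⁺ E≢ (All.map <⇒≢ A₁′<)) (All.map <⇒≢ IU<)
                                          (trans (sym Rs′) R≡′) =
    trans U≡ (trans (cong (_∷ʳ (k + t)) (sym E++A₁′≡)) (++-assoc E A₁′ _)) , sym R₁≡
  ... | inj₂ (E₁ , E₂ , E≡ , E₁≢)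
    with E₁≡IU , _ ← first-occurrence-unique E₁ IU E₁≢ (All.map <⇒≢ IU<)
           (trans (sym (trans Rs (trans (cong (_++ (A₁′ ∷ʳ (k + t)) ++ E ++ Ys) E≡) (++-assoc E₁ _ _)))) R≡′)
    = ⊥-elim (R-¬factor t (E ++ A₁′) (trans Rs′ (cong (λ e → (E ++ A₁′) ++ (k + t) ∷ e) E++Ys≡)))
    where
    E++Ys≡ : E ++ Ys ≡ U t ++ E₂ ++ Ys
    E++Ys≡ = begin
      E ++ Ys                          ≡⟨ cong (_++ Ys) E≡ ⟩
      (E₁ ++ (k + t) ∷ E₂) ++ Ys       ≡⟨ cong (λ e → (e ++ (k + t) ∷ E₂) ++ Ys) E₁≡IU ⟩
      (IU ++ (k + t) ∷ E₂) ++ Ys       ≡⟨ cong (_++ Ys) (++-assoc IU [ k + t ] E₂) ⟨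
      ((IU ∷ʳ (k + t)) ++ E₂) ++ Ys    ≡⟨ cong (λ u → (u ++ E₂) ++ Ys) U≡ ⟨
      (U t ++ E₂) ++ Ys                ≡⟨ ++-assoc (U t) E₂ Ys ⟩
      U t ++ E₂ ++ Ys                  ∎

  square-short : ∀ {t V} → LongestRepeatedPrefix t V → ∀ A₁ E {Xs Ys} → A₁ ≢ [] →
    L t ≡ Xs ++ A₁ → R t ≡ E ++ A₁ ++ E ++ Ys → ∃ λ j → j ≤ length V × A₁ ++ E ≡ C j (U t)
  square-short {t} {V} lrp A₁ E {Xs} {Ys} A₁≢[] Ls Rs
    with A₁′ , A₁≡ , A₁′< ← L-suffix-∷ʳ t Xs A₁ Ls A₁≢[]
                              (subst (length A₁ ≤_) (cong length (sym Rs)) (length-≤-infix E A₁ (E ++ Ys)))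
    with R₁ , R≡ , mcp ← R-after-U lrp
    with U≡ , R₁≡ ← U-prefix-of-R t A₁′ E A₁′< R≡ (subst (λ a → R t ≡ E ++ a ++ E ++ Ys) A₁≡ Rs)
    = length E , ≤-trans (mcp-length mcp E U≡E++A₁ R₁≡) (≤-reflexive (length-⊕ k V)) ,
      sym (trans (cong (C (length E)) U≡E++A₁) (C-length-++ E A₁))
    where
    U≡E++A₁ : U t ≡ E ++ A₁
    U≡E++A₁ = trans U≡ (cong (E ++_) (sym A₁≡))

  W-¬block-suffix : ∀ d r α₀ → 0 < r → r ≤ k₂ → W k (k + d) ≢ (α₀ ++ Wrange k (k₁ + d) r) ++ k ⊕ W k d
  W-¬block-suffix d (suc r) α₀ _ r<k₂ eq = Wrange-¬suffix (k₁ + d) r (k₂ ∸ suc r) α₀ r<k₁+d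
    (trans (cong (Wrange k (k₁ + d)) k₁≡) (++-cancelʳ (k ⊕ W k d) _ _ (trans (sym (W-recurrence d)) eq)))
    where
    k₁≡ : suc r + suc (k₂ ∸ suc r) ≡ k₁
    k₁≡ = trans (+-suc (suc r) (k₂ ∸ suc r)) (cong suc (m+[n∸m]≡n r<k₂))
    r<k₁+d : r < k₁ + d
    r<k₁+d = ≤-trans (m≤n⇒m≤1+n r<k₂) (m≤m+n k₁ d)

  L-block-index : ∀ t i r → i + r ≡ k₂ → k₂ + (k + t) ∸ i ≡ k + (r + t)
  L-block-index t i r i+r≡k₂ = begin
    k₂ + (k + t) ∸ i          ≡⟨ cong (λ x → x + (k + t) ∸ i) (sym i+r≡k₂) ⟩
    i + r + (k + t) ∸ i       ≡⟨ cong (_∸ i) (+-assoc i r (k + t)) ⟩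
    i + (r + (k + t)) ∸ i     ≡⟨ m+n∸m≡n i (r + (k + t)) ⟩
    r + (k + t)               ≡⟨ +-assoc r k t ⟨
    r + k + t                 ≡⟨ cong (_+ t) (+-comm r k) ⟩
    k + r + t                 ≡⟨ +-assoc k r t ⟩
    k + (r + t)               ∎

  R-prefix-≢0 : ∀ t {A₂ Ys} → R t ≡ A₂ ++ Ys → All (_≢ 0) A₂
  R-prefix-≢0 t {A₂} Rt =
    All.map (λ { k≤x refl → <⇒≱ (s≤s z≤n) k≤x }) (++⁻ˡ A₂ (subst (All (k ≤_)) Rt (⊕-All≥ k (W k (k₁ + t)))))

  square-long-in-block : ∀ t r α₀ α′ {A₂ E Ys} → r ≤ k₂ → E ≢ [] → A₂ ≢ [] → R t ≡ A₂ ++ Ys →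
    W k (k + (r + t)) ≡ α₀ ++ α′ ∷ʳ (k + (r + t)) → All (_< k + (r + t)) α′ →
    α′ ++ (k + (r + t)) ∷ Wrange k (k₁ + (r + t)) r ≡ E ++ A₂ ++ E → ⊥
  square-long-in-block t r α₀ α′ {A₂} {E} r≤k₂ E≢[] A₂≢[] Rt Wj α′< eq
    with refl , α′∷ʳ≡ ← solitary-letter-ends-middle α′ (Wrange k (k₁ + (r + t)) r) E A₂ (All.map <⇒≢ α′<)
           (All.map (λ z≤ → <⇒≢ (s≤s z≤)) (Wrange-All≤ (k₁ + (r + t)) r))
           (λ Z≡ → subst (λ z → All (_≢ z) A₂) (sym (Wrange-head (k₁ + (r + t)) r Z≡)) (R-prefix-≢0 t Rt)) eq
    with G , A₂≡ , α′≡ ← suffix-∷ʳ (Wrange k (k₁ + (r + t)) r) A₂ α′ α′∷ʳ≡ A₂≢[]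
    with A₂≡⊕ ← ⊕W-firstOccurrence k (r + t) (k₁ + t) A₂ G (+-monoˡ-≤ t (m≤n⇒m≤1+n r≤k₂)) Rt A₂≡
                  (++⁻ʳ _ (subst (All (_< k + (r + t))) α′≡ α′<))
    = W-¬block-suffix (r + t) r α₀ (Wrange-≢[]⇒0< (k₁ + (r + t)) r E≢[]) r≤k₂ (begin
      W k (k + (r + t))                                  ≡⟨ Wj ⟩
      α₀ ++ α′ ∷ʳ (k + (r + t))                          ≡⟨ cong (α₀ ++_) α′∷ʳ≡ ⟩
      α₀ ++ Wrange k (k₁ + (r + t)) r ++ A₂              ≡⟨ ++-assoc α₀ _ A₂ ⟨
      (α₀ ++ Wrange k (k₁ + (r + t)) r) ++ A₂            ≡⟨ cong (_ ++_) A₂≡⊕ ⟩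
      (α₀ ++ Wrange k (k₁ + (r + t)) r) ++ k ⊕ W k (r + t) ∎)

  square-long : ∀ t {A₁ A₂ E Xs Ys} → E ≢ [] → A₂ ≢ [] →
    L t ≡ Xs ++ A₁ → R t ≡ A₂ ++ Ys → A₁ ≡ E ++ A₂ ++ E → ⊥
  square-long t {A₁} {A₂} {E} {Xs} {Ys} E≢[] A₂≢[] Ls Rt A₁≡
    with i , α₀ , α , i<k₁ , Wα , α≢[] , A₁≡α++Z ← Wrange-suffix (k₂ + (k + t)) k₁ Xs A₁ Ls
                                                     (λ A₁≡[] → E≢[] (++-conicalˡ E _ (trans (sym A₁≡) A₁≡[])))
    with r , i+r≡k₂ ← m≤n⇒∃[o]m+o≡n (≤-pred i<k₁)
    with idx ← L-block-index t i r i+r≡k₂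
    with α′ , refl , α′< ← W-suffix-∷ʳ (k + (r + t)) α₀ α (trans (cong (W k) (sym idx)) Wα) α≢[]
    = square-long-in-block t r α₀ α′ (≤-trans (m≤n+m r i) (≤-reflexive i+r≡k₂)) E≢[] A₂≢[] Rt
        (trans (cong (W k) (sym idx)) Wα) α′< A₁-shape
    where
    j : ℕ
    j = k + (r + t)
    A₁-shape : α′ ++ j ∷ Wrange k (k₁ + (r + t)) r ≡ E ++ A₂ ++ E
    A₁-shape = begin
      α′ ++ j ∷ Wrange k (k₁ + (r + t)) r                     ≡⟨ ++-assoc α′ [ j ] _ ⟨
      (α′ ∷ʳ j) ++ Wrange k (k₁ + (r + t)) r                  ≡⟨ cong₂ (λ a b → (α′ ∷ʳ j) ++ Wrange k a b) (cong (_∸ 1) idx) k₂∸i≡r ⟨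
      (α′ ∷ʳ j) ++ Wrange k (k₂ + (k + t) ∸ i ∸ 1) (k₂ ∸ i)   ≡⟨ A₁≡α++Z ⟨
      A₁                                                      ≡⟨ A₁≡ ⟩
      E ++ A₂ ++ E                                            ∎
      where
      k₂∸i≡r : k₂ ∸ i ≡ r
      k₂∸i≡r = trans (cong (_∸ i) (sym i+r≡k₂)) (m+n∸m≡n i r)

  square-exists : ∀ {t V} → LongestRepeatedPrefix t V → ∀ j → j ≤ length V →
    StraddlingSquareIn (L t) (R t) (C j (U t) ++ C j (U t))
  square-exists {t} {V} lrp j j≤|V|
    with R₁ , R≡ , mcp ← R-after-U lrp | X , L≡ ← L-ends-with-U t =
    (C j (U t) , refl) ,
    (drop j (U t) , U t ++ take j (U t) , drop-≢[] j (U t) j<|U| , (λ eq → U≢[] t (++-conicalˡ (U t) _ eq)) , S≡ ,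
     (X ++ take j (U t) , L≡′) , (drop j R₁ , R≡′))
    where
    j≤ : j ≤ length (k ⊕ V)
    j≤ = ≤-trans j≤|V| (≤-reflexive (sym (length-⊕ k V)))
    j<|U| : j < length (U t)
    j<|U| = ≤-<-trans j≤ (mcp-length-< mcp)
    S≡ : C j (U t) ++ C j (U t) ≡ drop j (U t) ++ U t ++ take j (U t)
    S≡ = begin
      (drop j (U t) ++ take j (U t)) ++ drop j (U t) ++ take j (U t)   ≡⟨ ++-assoc (drop j (U t)) _ _ ⟩
      drop j (U t) ++ take j (U t) ++ drop j (U t) ++ take j (U t)     ≡⟨ cong (drop j (U t) ++_) (++-assoc (take j (U t)) _ _) ⟨
      drop j (U t) ++ (take j (U t) ++ drop j (U t)) ++ take j (U t)   ≡⟨ cong (λ u → drop j (U t) ++ u ++ take j (U t))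
                                                                              (take++drop≡id j (U t)) ⟩
      drop j (U t) ++ U t ++ take j (U t)                              ∎
    L≡′ : L t ≡ (X ++ take j (U t)) ++ drop j (U t)
    L≡′ = begin
      L t                                       ≡⟨ L≡ ⟩
      X ++ U t                                  ≡⟨ cong (X ++_) (take++drop≡id j (U t)) ⟨
      X ++ take j (U t) ++ drop j (U t)         ≡⟨ ++-assoc X _ _ ⟨
      (X ++ take j (U t)) ++ drop j (U t)       ∎
    R≡′ : R t ≡ (U t ++ take j (U t)) ++ drop j R₁
    R≡′ = begin
      R t                                       ≡⟨ R≡ ⟩
      U t ++ R₁                                 ≡⟨ cong (U t ++_) (take++drop≡id j R₁) ⟨
      U t ++ take j R₁ ++ drop j R₁             ≡⟨ cong (λ u → U t ++ u ++ drop j R₁) (mcp-take mcp j j≤) ⟨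
      U t ++ take j (U t) ++ drop j R₁          ≡⟨ ++-assoc (U t) _ _ ⟨
      (U t ++ take j (U t)) ++ drop j R₁        ∎

  square-unique : ∀ {t V} → LongestRepeatedPrefix t V → ∀ S → StraddlingSquareIn (L t) (R t) S →
    ∃ λ j → j ≤ length V × S ≡ C j (U t) ++ C j (U t)
  square-unique {t} lrp S ((B , S≡BB) , (A₁ , A₂ , A₁≢[] , A₂≢[] , S≡ , (Xs , Ls) , (Ys , Rs)))
    with ++-equidivisible A₁ B (trans (sym S≡) S≡BB)
  ... | inj₁ (E , B≡ , A₂≡)
    with j , j≤ , A₁E≡ ← square-short lrp A₁ E A₁≢[] Ls (trans Rs (trans (cong (_++ Ys) (trans A₂≡ (cong (E ++_) B≡)))
                                                                     (trans (++-assoc E _ Ys) (cong (E ++_) (++-assoc A₁ E Ys)))))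
    = j , j≤ , trans S≡BB (cong₂ _++_ (trans B≡ A₁E≡) (trans B≡ A₁E≡))
  ... | inj₂ ([] , A₁≡ , B≡)
    with j , j≤ , A₁E≡ ← square-short lrp A₁ [] A₁≢[] Ls
                           (trans Rs (cong (_++ Ys) (trans (sym B≡) (trans (sym (++-identityʳ B)) (sym A₁≡)))))
    = j , j≤ , trans S≡BB (cong₂ _++_ B≡C B≡C)
    where
    B≡A₁ : B ≡ A₁
    B≡A₁ = trans (sym (++-identityʳ B)) (sym A₁≡)
    B≡C : B ≡ C j (U t)
    B≡C = trans B≡A₁ (trans (sym (++-identityʳ A₁)) A₁E≡)
  ... | inj₂ (x ∷ E , A₁≡ , B≡) = ⊥-elim (square-long t {E = x ∷ E} (λ ()) A₂≢[] Ls Rs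
                                    (trans A₁≡ (trans (cong (_++ x ∷ E) B≡) (++-assoc (x ∷ E) A₂ (x ∷ E)))))

  longestRepeatedPrefix-small : ∀ t → suc (suc (suc t)) ≤ k → LongestRepeatedPrefix (suc t) (Wrange k t (suc t))
  longestRepeatedPrefix-small t t+3≤k = Wrange k t (suc t) ∷ʳ suc (suc t) , W2+t , record
    { a≢b = λ eq → <-irrefl eq (n<1+n (suc t)) ; P≡ = W-small t (≤-trans (n≤1+n _) t+3≤k) ; Q≡ = refl }
    where
    W2+t : W k (suc (suc t)) ≡ W k (suc t) ++ Wrange k t (suc t) ∷ʳ suc (suc t)
    W2+t = begin
      W k (suc (suc t))                                    ≡⟨ W-small (suc t) t+3≤k ⟩
      Wrange k (suc t) (suc (suc t)) ∷ʳ suc (suc t)        ≡⟨ ++-assoc (W k (suc t)) (Wrange k t (suc t)) _ ⟩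
      W k (suc t) ++ Wrange k t (suc t) ∷ʳ suc (suc t)     ∎

  Wrange-prefix-W : ∀ e → ∃ λ X → W k (k₁ + e) ≡ Wrange k (k₂ + e) k₂ ++ 0 ∷ X
  Wrange-prefix-W zero = k₁ ∷ [] , (begin
    W k (k₁ + 0)                         ≡⟨ cong (W k) (+-identityʳ k₁) ⟩
    W k k₁                               ≡⟨ W-small k₂ ≤-refl ⟩
    Wrange k k₂ k₁ ∷ʳ k₁                 ≡⟨ cong (_∷ʳ k₁) (Wrange-∷ʳ k₂ k₂) ⟩
    (Wrange k k₂ k₂ ++ W k (k₂ ∸ k₂)) ∷ʳ k₁ ≡⟨ cong (λ s → (Wrange k k₂ k₂ ++ W k s) ∷ʳ k₁) (n∸n≡0 k₂) ⟩
    (Wrange k k₂ k₂ ++ [ 0 ]) ∷ʳ k₁      ≡⟨ ++-assoc (Wrange k k₂ k₂) [ 0 ] [ k₁ ] ⟩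
    Wrange k k₂ k₂ ++ 0 ∷ k₁ ∷ []        ≡⟨ cong (λ s → Wrange k s k₂ ++ 0 ∷ k₁ ∷ []) (+-identityʳ k₂) ⟨
    Wrange k (k₂ + 0) k₂ ++ 0 ∷ k₁ ∷ []  ∎)
  Wrange-prefix-W (suc e) with X , eq ← Wrange-prefix-W e = 1 ∷ φ* k X , (begin
    W k (k₁ + suc e)                                ≡⟨ cong (W k) (+-suc k₁ e) ⟩
    φ* k (W k (k₁ + e))                             ≡⟨ cong (φ* k) eq ⟩
    φ* k (Wrange k (k₂ + e) k₂ ++ 0 ∷ X)            ≡⟨ φ*-++ (Wrange k (k₂ + e) k₂) (0 ∷ X) ⟩
    φ* k (Wrange k (k₂ + e) k₂) ++ φ* k (0 ∷ X)     ≡⟨ cong₂ _++_ (φ*-Wrange (k₂ + e) k₂ (≤-trans (m≤m+n k₂ e) (n≤1+n _)))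
                                                                   (cong (_++ φ* k X) φ-0) ⟩
    Wrange k (suc (k₂ + e)) k₂ ++ 0 ∷ 1 ∷ φ* k X    ≡⟨ cong (λ s → Wrange k s k₂ ++ 0 ∷ 1 ∷ φ* k X) (+-suc k₂ e) ⟨
    Wrange k (k₂ + suc e) k₂ ++ 0 ∷ 1 ∷ φ* k X      ∎)

  longestRepeatedPrefix-large : ∀ e → LongestRepeatedPrefix (k₁ + e) (Wrange k (k₂ + e) k₂)
  longestRepeatedPrefix-large e with X , Wt ← Wrange-prefix-W e | r , We ← W-head e =
    Wrange k (k₂ + e) k₂ ++ k ⊕ W k e , W1+t ,
    record { a≢b = λ () ; P≡ = Wt ; Q≡ = cong (λ w → Wrange k (k₂ + e) k₂ ++ k ⊕ w) We }
    where
    W1+t : W k (suc (k₁ + e)) ≡ W k (k₁ + e) ++ Wrange k (k₂ + e) k₂ ++ k ⊕ W k e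
    W1+t = trans (W-recurrence e) (++-assoc (W k (k₁ + e)) _ _)


  V-longestRepeatedPrefix : ∀ t → LongestRepeatedPrefix (suc t) (V k (k₁ + (k + suc t)))
  V-longestRepeatedPrefix t with k₁ + (k + suc t) <? 3 * k ∸ 2
  ... | yes lt = subst (λ s → LongestRepeatedPrefix (suc t) (Wrange k s (suc s))) (sym n∸2k≡t)
                   (longestRepeatedPrefix-small t (+-cancelˡ-≤ (k₂ + k) _ _ (subst₂ _≤_ (index-3k-left k₂ t) (index-3k-right k₂) lt)))
    where
    n∸2k≡t : k₁ + (k + suc t) ∸ 2 * k ≡ t
    n∸2k≡t = trans (cong (_∸ 2 * k) (index-V k₂ t)) (m+n∸n≡m t (2 * k))
  ... | no ¬lt with e , refl ← m≤n⇒∃[o]m+o≡n (≤-pred (≤-pred (+-cancelˡ-≤ (k₂ + k) k (suc (suc t))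
                    (subst₂ _≤_ (index-3k-right k₂) (index-3k-n k₂ t) (≮⇒≥ ¬lt)))))
    = subst (λ s → LongestRepeatedPrefix (k₁ + e) (Wrange k s k₂)) (sym n∸2k≡t) (longestRepeatedPrefix-large e)
    where
    n∸2k≡t : k₁ + (k + suc (k₂ + e)) ∸ 2 * k ≡ k₂ + e
    n∸2k≡t = trans (cong (_∸ 2 * k) (index-V k₂ (k₂ + e))) (m+n∸n≡m (k₂ + e) (2 * k))

  n-index : ∀ n → 2 * k ∸ 1 < n → ∃ λ t → n ≡ k₁ + (k + suc t)
  n-index n 2k∸1<n with t , eq ← m≤n⇒∃[o]m+o≡n 2k∸1<n = t , trans (sym eq) (index-from-bound k₂ t)

  U-index : ∀ t → k₁ + (k + suc t) + 1 ∸ 2 * k ≡ suc t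
  U-index t = trans (cong (_∸ 2 * k) (index-U k₂ t)) (m+n∸n≡m (suc t) (2 * k))

  R-index : ∀ t → k₁ + (k + suc t) ∸ k ≡ k₁ + suc t
  R-index t = trans (cong (_∸ k) (index-right k₂ t)) (m+n∸n≡m (k₁ + suc t) k)

  straddling-squares : ∀ n → 2 * k ∸ 1 < n →
      ((j : ℕ) → j ≤ length (V k n) →
        StraddlingSquare k n (C j (k ⊕ W k (n + 1 ∸ 2 * k)) ++ C j (k ⊕ W k (n + 1 ∸ 2 * k))))
      × ((S : Word) → StraddlingSquare k n S →
        ∃ λ j → j ≤ length (V k n) ×
          S ≡ C j (k ⊕ W k (n + 1 ∸ 2 * k)) ++ C j (k ⊕ W k (n + 1 ∸ 2 * k)))
  straddling-squares n 2k∸1<n with t , refl ← n-index n 2k∸1<n =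
    (λ j j≤ → subst₂ (λ r u → StraddlingSquareIn (L (suc t)) (k ⊕ W k r) (C j (k ⊕ W k u) ++ C j (k ⊕ W k u)))
                (sym (R-index t)) (sym (U-index t)) (square-exists (V-longestRepeatedPrefix t) j j≤)) ,
    (λ S sq → let j , j≤ , S≡ = square-unique (V-longestRepeatedPrefix t) S
                                  (subst (λ r → StraddlingSquareIn (L (suc t)) (k ⊕ W k r) S) (R-index t) sq)
              in j , j≤ , subst (λ u → S ≡ C j (k ⊕ W k u) ++ C j (k ⊕ W k u)) (sym (U-index t)) S≡)


theorem38 : (k : ℕ) → .{{_ : NonZero k}} → 3 ≤ k → (n : ℕ) → 2 * k ∸ 1 < n →
    ((j : ℕ) → j ≤ length (V k n) →
      StraddlingSquare k n (C j (k ⊕ W k (n + 1 ∸ 2 * k)) ++ C j (k ⊕ W k (n + 1 ∸ 2 * k))))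
    × ((S : Word) → StraddlingSquare k n S →
      ∃ λ j → j ≤ length (V k n) ×
        S ≡ C j (k ⊕ W k (n + 1 ∸ 2 * k)) ++ C j (k ⊕ W k (n + 1 ∸ 2 * k)))
-- The argument only needs k ≥ 2.
theorem38 (suc (suc k₂)) _ = Squares.straddling-squares k₂
theorem38 (suc zero) (s≤s ())
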